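{- Let $\mathbb{K}$ be a field, $X$ a countable alphabet, and $\Box$ a weak stuffle product on $\mathbb{K}\langle X\rangle$ with maps $f_1,f_2,f_3$. Let $\Delta:\mathbb{K}\langle X\rangle\to\mathbb{K}\langle X\rangle\otimes\mathbb{K}\langle X\rangle$ be the deconcatenation coproduct, $\Delta(w)=\sum_{u,v\in X^*,\ uv=w}u\otimes v$. If $\Delta$ is an algebra morphism from $(\mathbb{K}\langle X\rangle,\Box)$ to $\mathbb{K}\langle X\rangle\otimes\mathbb{K}\langle X\rangle$ equipped with the product $(u\otimes v)(u'\otimes v')=(u\Box u')\otimes(v\Box v')$, then the underlying weak shuffle product (the product with the same $f_1,f_2$ and $f_3\equiv0$) is the classical shuffle product, i.e. $f_1(a\otimes b)=f_2(a\otimes b)=1$ for all letters $a,b\in X$.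
   Context: An alphabet is a non-empty finite or countable set $X$; $X^*$ is the set of words (empty word $1$), $\mathbb{K}\langle X\rangle$ the vector space with basis $X^*$, juxtaposition is concatenation, $\mathbb{K}.X$ the span of letters. A weak stuffle product on $\mathbb{K}\langle X\rangle$ is an associative and commutative bilinear product $\Box$ with $u\Box 1=1\Box u=u$, $u\Box0=0\Box u=0$, and $au\Box bv=f_1(a\otimes b)\,a(u\Box bv)+f_2(a\otimes b)\,b(au\Box v)+f_3(a\otimes b)(u\Box v)$ for letters $a,b$ and words $u,v$, where $f_1,f_2:\mathbb{K}.X\otimes\mathbb{K}.X\to\mathbb{K}$ are linear and $f_3:\mathbb{K}.X\otimes\mathbb{K}.X\to\mathbb{K}.X$ is linear with $f_3(a\otimes b)$ a scalar multiple of a single letter. -}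

module Defs where

open import Level using (Level; _⊔_) renaming (suc to lsuc)
open import Algebra.Bundles using (CommutativeRing)
open import Data.Nat using (ℕ)
import Data.Nat.Properties as ℕP
open import Data.List using (List; []; _∷_; map; concatMap; foldr; _++_)
import Data.List.Properties as LP
open import Data.Product using (_×_; _,_; Σ; proj₁; proj₂)
open import Function.Definitions using (Injective)
open import Relation.Binary.PropositionalEquality using (_≡_; refl; cong)
open import Relation.Binary.Definitions using (DecidableEquality)
open import Relation.Nullary using (¬_; yes; no)

record Field (c ℓ : Level) : Set (lsuc (c ⊔ ℓ)) where
  field
    commutativeRing : CommutativeRing c ℓ
  open CommutativeRing commutativeRing public
  field
    0≉1     : ¬ (0# ≈ 1#)
    inverse : ∀ x → ¬ (x ≈ 0#) → Σ Carrier (λ y → x * y ≈ 1#)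

-- A countable alphabet: a type X with an injection into ℕ (non-emptiness
-- is supplied separately as a witness). Decidable equality follows.
countable-≟ : {X : Set} (ι : X → ℕ) → Injective _≡_ _≡_ ι → DecidableEquality X
countable-≟ ι inj a b with ι a ℕP.≟ ι b
... | yes e = yes (inj e)
... | no ne = no (λ e → ne (cong ι e))

-- A linear map K.X ⊗ K.X → K is determined by its values on pairs of letters;
-- a linear map f₃ : K.X ⊗ K.X → K.X with f₃(a⊗b) a scalar multiple of a
-- single letter is given by  f₃ a b = (scalar , letter).
module WeakStuffle {c ℓ} (K : Field c ℓ) (X : Set) (_≟X_ : DecidableEquality X)
    (f₁ f₂ : X → X → Field.Carrier K)
    (f₃ : X → X → Field.Carrier K × X) where

  open Field K

  Word : Set
  Word = List X

  _≟W_ : DecidableEquality Word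
  _≟W_ = LP.≡-dec _≟X_

  Poly : Set c
  Poly = List (Carrier × Word)

  Tens : Set c
  Tens = List (Carrier × Word × Word)

  coeff : Poly → Word → Carrier
  coeff [] w = 0#
  coeff ((k , u) ∷ p) w with u ≟W w
  ... | yes _ = k + coeff p w
  ... | no  _ = coeff p w

  coeffT : Tens → Word → Word → Carrier
  coeffT [] u v = 0#
  coeffT ((k , u' , v') ∷ t) u v with u' ≟W u | v' ≟W v
  ... | yes _ | yes _ = k + coeffT t u v
  ... | _     | _     = coeffT t u v

  _≈P_ : Poly → Poly → Set ℓ
  p ≈P q = ∀ w → coeff p w ≈ coeff q w

  _≈T_ : Tens → Tens → Set ℓ
  s ≈T t = ∀ u v → coeffT s u v ≈ coeffT t u v

  word : Word → Poly
  word w = (1# , w) ∷ []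

  _·P_ : Carrier → Poly → Poly
  k ·P p = map (λ { (d , w) → (k * d , w) }) p

  _◃_ : X → Poly → Poly
  a ◃ p = map (λ { (d , w) → (d , a ∷ w) }) p

  _□_ : Word → Word → Poly
  [] □ v = word v
  (a ∷ u) □ [] = word (a ∷ u)
  (a ∷ u) □ (b ∷ v) =
       (f₁ a b ·P (a ◃ (u □ (b ∷ v))))
    ++ (f₂ a b ·P (b ◃ ((a ∷ u) □ v)))
    ++ (proj₁ (f₃ a b) ·P (proj₂ (f₃ a b) ◃ (u □ v)))

  _□P_ : Poly → Poly → Poly
  p □P q = concatMap (λ { (k , u) → concatMap (λ { (l , v) → (k * l) ·P (u □ v) }) q }) p

  IsWeakStuffle : Set ℓ
  IsWeakStuffle =
      (∀ u v → (u □ v) ≈P (v □ u))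
    × (∀ u v w → ((u □ v) □P word w) ≈P (word u □P (v □ w)))

  _⊗_ : Poly → Poly → Tens
  p ⊗ q = concatMap (λ { (k , u) → map (λ { (l , v) → (k * l , u , v) }) q }) p

  _⋆_ : Tens → Tens → Tens
  s ⋆ t = concatMap (λ { (k , u , v) → concatMap (λ { (l , u' , v') →
            map (λ { (m , a , b) → (k * l * m , a , b) }) ((u □ u') ⊗ (v □ v')) }) t }) s

  Δw : Word → Tens
  Δw [] = (1# , [] , []) ∷ []
  Δw (a ∷ w) = (1# , [] , a ∷ w) ∷ map (λ { (k , u , v) → (k , a ∷ u , v) }) (Δw w)

  Δ : Poly → Tens
  Δ p = concatMap (λ { (k , w) → map (λ { (l , u , v) → (k * l , u , v) }) (Δw w) }) p

  ΔIsAlgebraMorphism : Set ℓ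
  ΔIsAlgebraMorphism =
      (Δ (word []) ≈T ((1# , [] , []) ∷ []))
    × (∀ u v → Δ (u □ v) ≈T (Δw u ⋆ Δw v))

module Submission where

-- Write p = f₁ a b, q = f₂ a b and compare coefficients
-- on both sides of  Δ (u □ v) = Δ u ⋆ Δ v  for a few short words.
--  * a ≠ b.  The coefficient of a⊗b in Δ(a □ b) is p (only the word ab
--    contributes, the f₃-letter is too short), while in Δa ⋆ Δb it is 1,
--    coming from (a⊗1)(1⊗b).  Symmetrically b⊗a gives q = 1.
--  * a = b.  The coefficient of a⊗a gives  p + q = 1 + 1, and the
--    coefficient of a⊗aa gives  p + q(p + q) = p + (q + 1).  Substituting
--    the first equation into the second yields q + q = q + 1, hence q = 1
--    and then p = 1; no division (and no assumption on the characteristic)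
--    is needed, so this step holds in any commutative ring.
-- Coefficients cannot be computed by normalisation, since equality of the
-- letters a, b is not decided definitionally; instead each coefficient is
-- read off from a certificate (CoeffIs) recording, entry by entry, whether
-- a term of the tensor matches the basis element u⊗v or why it does not
-- (mismatches are mostly visible from word lengths, otherwise from a ≠ b).

open import Defs
open import Level using (Level)
open import Algebra.Bundles using (CommutativeRing)
open import Data.Nat using (ℕ)
open import Data.List using ([]; _∷_)
open import Data.Product using (_×_; _,_)
open import Data.Empty using (⊥-elim)
open import Function.Definitions using (Injective)
open import Relation.Binary.Definitions using (DecidableEquality)
open import Relation.Binary.PropositionalEquality using (_≡_; _≢_; ≢-sym)
  renaming (refl to ≡-refl)
open import Relation.Nullary using (yes; no)
import Algebra.Properties.Group as GroupProperties
import Relation.Binary.Reasoning.Setoid as SetoidReasoning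

module _ {c ℓ : Level} (R : CommutativeRing c ℓ) where
  open CommutativeRing R
  open SetoidReasoning setoid
  open GroupProperties +-group using (∙-cancelˡ)

  both-one : ∀ p q → p + q ≈ 1# + 1# → p + (q * p + q * q) ≈ p + (q + 1#) →
             (p ≈ 1#) × (q ≈ 1#)
  both-one p q sum quadratic = p≈1 , q≈1
    where
    -- q (p + q) = 2q, so the second equation says p + 2q = p + q + 1
    q+q≈q+1 : q + q ≈ q + 1#
    q+q≈q+1 = ∙-cancelˡ p _ _ (begin
      p + (q + q)             ≈⟨ +-cong refl (sym (+-cong (*-identityʳ q) (*-identityʳ q))) ⟩
      p + (q * 1# + q * 1#)   ≈⟨ +-cong refl (sym (distribˡ q 1# 1#)) ⟩
      p + q * (1# + 1#)       ≈⟨ +-cong refl (*-cong refl (sym sum)) ⟩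
      p + q * (p + q)         ≈⟨ +-cong refl (distribˡ q p q) ⟩
      p + (q * p + q * q)     ≈⟨ quadratic ⟩
      p + (q + 1#)            ∎)

    q≈1 : q ≈ 1#
    q≈1 = ∙-cancelˡ q _ _ q+q≈q+1

    p≈1 : p ≈ 1#
    p≈1 = ∙-cancelˡ 1# _ _ (begin
      1# + p   ≈⟨ +-comm 1# p ⟩
      p + 1#   ≈⟨ +-cong refl (sym q≈1) ⟩
      p + q    ≈⟨ sum ⟩
      1# + 1#  ∎)

module Coefficients {c ℓ : Level} (K : Field c ℓ) (X : Set) (_≟X_ : DecidableEquality X)
    (f₁ f₂ : X → X → Field.Carrier K) (f₃ : X → X → Field.Carrier K × X) where
  open Field K
  open WeakStuffle K X _≟X_ f₁ f₂ f₃

  data CoeffIs : Tens → Word → Word → Carrier → Set c where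
    done  : ∀ {u v} → CoeffIs [] u v 0#
    here  : ∀ {k t u v r} → CoeffIs t u v r → CoeffIs ((k , u , v) ∷ t) u v (k + r)
    skipˡ : ∀ {k u' v' t u v r} → u' ≢ u → CoeffIs t u v r → CoeffIs ((k , u' , v') ∷ t) u v r
    skipʳ : ∀ {k u' v' t u v r} → v' ≢ v → CoeffIs t u v r → CoeffIs ((k , u' , v') ∷ t) u v r

  coeffIs-sound : ∀ {t u v r} → CoeffIs t u v r → coeffT t u v ≈ r
  coeffIs-sound done = refl
  coeffIs-sound (here {u = u} {v} cert) with u ≟W u | v ≟W v
  ... | yes _ | yes _   = +-cong refl (coeffIs-sound cert)
  ... | no u≢u | _      = ⊥-elim (u≢u ≡-refl)
  ... | yes _ | no v≢v  = ⊥-elim (v≢v ≡-refl)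
  coeffIs-sound (skipˡ {u' = u'} {v'} {u = u} {v} u'≢u cert) with u' ≟W u | v' ≟W v
  ... | yes u'≡u | _    = ⊥-elim (u'≢u u'≡u)
  ... | no _ | _        = coeffIs-sound cert
  coeffIs-sound (skipʳ {u' = u'} {v'} {u = u} {v} v'≢v cert) with u' ≟W u | v' ≟W v
  ... | _ | yes v'≡v    = ⊥-elim (v'≢v v'≡v)
  ... | yes _ | no _    = coeffIs-sound cert
  ... | no _ | no _     = coeffIs-sound cert

  [_] : X → Word
  [ a ] = a ∷ []

  singleton-≢ : ∀ {a b} → a ≢ b → [ a ] ≢ [ b ]
  singleton-≢ a≢b ≡-refl = a≢b ≡-refl

  MultiplicativeAt : Word → Word → Word → Word → Set ℓ
  MultiplicativeAt u v x y = coeffT (Δ (u □ v)) x y ≈ coeffT (Δw u ⋆ Δw v) x y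

  x·1·1≈x : ∀ x → x * 1# * 1# ≈ x
  x·1·1≈x x = trans (*-identityʳ _) (*-identityʳ x)

  1·1·[1·[x·1]]≈x : ∀ x → 1# * 1# * (1# * (x * 1#)) ≈ x
  1·1·[1·[x·1]]≈x x = trans (*-cong (*-identityʳ 1#) (*-identityˡ _))
                            (trans (*-identityˡ _) (*-identityʳ x))

  1·1·[1·1]≈1 : 1# * 1# * (1# * 1#) ≈ 1#
  1·1·[1·1]≈1 = trans (*-cong (*-identityʳ 1#) (*-identityʳ 1#)) (*-identityʳ 1#)

  x·[y·1]·1≈x·y : ∀ x y → x * (y * 1#) * 1# ≈ x * y
  x·[y·1]·1≈x·y x y = trans (*-identityʳ _) (*-cong refl (*-identityʳ y))

  -- Distinct letters a ≠ b: a⊗b is hit only by the word ab in Δ(a □ b)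
  -- and only by (a⊗1)(1⊗b) in Δa ⋆ Δb; likewise for b⊗a with the word ba.
  -- Each certificate walks the terms in the order Δ and ⋆ produce them.
  module _ {a b : X} (a≢b : a ≢ b) where
    private
      [a]≢[b] : [ a ] ≢ [ b ]
      [a]≢[b] = singleton-≢ a≢b

      [b]≢[a] : [ b ] ≢ [ a ]
      [b]≢[a] = singleton-≢ (≢-sym a≢b)

    Δ[a□b]-at-a⊗b : coeffT (Δ ([ a ] □ [ b ])) [ a ] [ b ] ≈ f₁ a b
    Δ[a□b]-at-a⊗b = trans (coeffIs-sound cert) (trans (+-identityʳ _) (x·1·1≈x _))
      where
      cert : CoeffIs (Δ ([ a ] □ [ b ])) [ a ] [ b ] (f₁ a b * 1# * 1# + 0#)
      cert = skipˡ (λ ()) (here (skipʳ (λ ()) (skipˡ (λ ()) (skipˡ [b]≢[a]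
               (skipˡ (λ ()) (skipˡ (λ ()) (skipʳ (λ ()) done)))))))

    Δa⋆Δb-at-a⊗b : coeffT (Δw [ a ] ⋆ Δw [ b ]) [ a ] [ b ] ≈ 1#
    Δa⋆Δb-at-a⊗b = trans (coeffIs-sound cert) (trans (+-identityʳ _) 1·1·[1·1]≈1)
      where
      cert : CoeffIs (Δw [ a ] ⋆ Δw [ b ]) [ a ] [ b ] (1# * 1# * (1# * 1#) + 0#)
      cert = skipˡ (λ ()) (skipˡ (λ ()) (skipˡ (λ ()) (skipˡ [b]≢[a] (here
               (skipʳ (λ ()) (skipʳ (λ ()) (skipʳ (λ ()) done)))))))

    Δ[a□b]-at-b⊗a : coeffT (Δ ([ a ] □ [ b ])) [ b ] [ a ] ≈ f₂ a b
    Δ[a□b]-at-b⊗a = trans (coeffIs-sound cert) (trans (+-identityʳ _) (x·1·1≈x _))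
      where
      cert : CoeffIs (Δ ([ a ] □ [ b ])) [ b ] [ a ] (f₂ a b * 1# * 1# + 0#)
      cert = skipˡ (λ ()) (skipˡ [a]≢[b] (skipˡ (λ ()) (skipˡ (λ ()) (here
               (skipʳ (λ ()) (skipˡ (λ ()) (skipʳ (λ ()) done)))))))

    Δa⋆Δb-at-b⊗a : coeffT (Δw [ a ] ⋆ Δw [ b ]) [ b ] [ a ] ≈ 1#
    Δa⋆Δb-at-b⊗a = trans (coeffIs-sound cert) (trans (+-identityʳ _) 1·1·[1·1]≈1)
      where
      cert : CoeffIs (Δw [ a ] ⋆ Δw [ b ]) [ b ] [ a ] (1# * 1# * (1# * 1#) + 0#)
      cert = skipˡ (λ ()) (skipˡ (λ ()) (skipˡ (λ ()) (here (skipˡ [a]≢[b]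
               (skipʳ (λ ()) (skipʳ (λ ()) (skipʳ (λ ()) done)))))))

    distinct-letters : MultiplicativeAt [ a ] [ b ] [ a ] [ b ] →
                       MultiplicativeAt [ a ] [ b ] [ b ] [ a ] →
                       (f₁ a b ≈ 1#) × (f₂ a b ≈ 1#)
    distinct-letters at-a⊗b at-b⊗a =
        trans (sym Δ[a□b]-at-a⊗b) (trans at-a⊗b Δa⋆Δb-at-a⊗b)
      , trans (sym Δ[a□b]-at-b⊗a) (trans at-b⊗a Δa⋆Δb-at-b⊗a)

  -- Terms coming
  -- from the f₃-letter never contribute: their words are too short.
  module _ (a : X) where
    private
      p q : Carrier
      p = f₁ a a
      q = f₂ a a

      [aa] : Word
      [aa] = a ∷ a ∷ []

    Δ[a□a]-at-a⊗a : coeffT (Δ ([ a ] □ [ a ])) [ a ] [ a ] ≈ p + q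
    Δ[a□a]-at-a⊗a = trans (coeffIs-sound cert)
                          (+-cong (x·1·1≈x p) (trans (+-identityʳ _) (x·1·1≈x q)))
      where
      cert : CoeffIs (Δ ([ a ] □ [ a ])) [ a ] [ a ] (p * 1# * 1# + (q * 1# * 1# + 0#))
      cert = skipˡ (λ ()) (here (skipˡ (λ ()) (skipˡ (λ ()) (here (skipˡ (λ ())
               (skipˡ (λ ()) (skipʳ (λ ()) done)))))))

    Δa⋆Δa-at-a⊗a : coeffT (Δw [ a ] ⋆ Δw [ a ]) [ a ] [ a ] ≈ 1# + 1#
    Δa⋆Δa-at-a⊗a = trans (coeffIs-sound cert)
                         (+-cong 1·1·[1·1]≈1 (trans (+-identityʳ _) 1·1·[1·1]≈1))
      where
      cert : CoeffIs (Δw [ a ] ⋆ Δw [ a ]) [ a ] [ a ]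
               (1# * 1# * (1# * 1#) + (1# * 1# * (1# * 1#) + 0#))
      cert = skipˡ (λ ()) (skipˡ (λ ()) (skipˡ (λ ()) (here (here
               (skipʳ (λ ()) (skipʳ (λ ()) (skipʳ (λ ()) done)))))))

    Δ[a□aa]-at-a⊗aa : coeffT (Δ ([ a ] □ [aa])) [ a ] [aa] ≈ p + (q * p + q * q)
    Δ[a□aa]-at-a⊗aa = trans (coeffIs-sound cert)
      (+-cong (x·1·1≈x p) (+-cong (x·[y·1]·1≈x·y q p) (trans (+-identityʳ _) (x·[y·1]·1≈x·y q q))))
      where
      cert : CoeffIs (Δ ([ a ] □ [aa])) [ a ] [aa]
               (p * 1# * 1# + (q * (p * 1#) * 1# + (q * (q * 1#) * 1# + 0#)))
      cert = skipˡ (λ ()) (here (skipˡ (λ ()) (skipˡ (λ ())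
             (skipˡ (λ ()) (here (skipˡ (λ ()) (skipˡ (λ ())
             (skipˡ (λ ()) (here (skipˡ (λ ()) (skipˡ (λ ())
             (skipˡ (λ ()) (skipʳ (λ ()) (skipˡ (λ ())
             (skipˡ (λ ()) (skipʳ (λ ()) (skipˡ (λ ()) done)))))))))))))))))

    Δa⋆Δaa-at-a⊗aa : coeffT (Δw [ a ] ⋆ Δw [aa]) [ a ] [aa] ≈ p + (q + 1#)
    Δa⋆Δaa-at-a⊗aa = trans (coeffIs-sound cert)
      (+-cong (1·1·[1·[x·1]]≈x p) (+-cong (1·1·[1·[x·1]]≈x q) (trans (+-identityʳ _) 1·1·[1·1]≈1)))
      where
      cert : CoeffIs (Δw [ a ] ⋆ Δw [aa]) [ a ] [aa]
               (1# * 1# * (1# * (p * 1#)) + (1# * 1# * (1# * (q * 1#)) + (1# * 1# * (1# * 1#) + 0#)))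
      cert = skipˡ (λ ()) (skipˡ (λ ()) (skipˡ (λ ()) (skipˡ (λ ()) (skipˡ (λ ())
             (here (here (skipʳ (λ ()) (skipˡ (λ ()) (here
             (skipʳ (λ ()) (skipʳ (λ ()) (skipʳ (λ ())
             (skipʳ (λ ()) (skipʳ (λ ()) (skipʳ (λ ()) (skipʳ (λ ()) (skipʳ (λ ()) done)))))))))))))))))

    equal-letters : MultiplicativeAt [ a ] [ a ] [ a ] [ a ] →
                    MultiplicativeAt [ a ] [aa] [ a ] [aa] →
                    (p ≈ 1#) × (q ≈ 1#)
    equal-letters at-a⊗a at-a⊗aa = both-one commutativeRing p q
      (trans (sym Δ[a□a]-at-a⊗a) (trans at-a⊗a Δa⋆Δa-at-a⊗a))
      (trans (sym Δ[a□aa]-at-a⊗aa) (trans at-a⊗aa Δa⋆Δaa-at-a⊗aa))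

-- Main theorem: only multiplicativity of Δ on one- and two-letter words is
-- needed.
mainTheorem14 : ∀ {c ℓ} (K : Field c ℓ) (X : Set) (x₀ : X)
    (ι : X → ℕ) (ι-inj : Injective _≡_ _≡_ ι)
    (f₁ f₂ : X → X → Field.Carrier K) (f₃ : X → X → Field.Carrier K × X) →
    let open Field K
        open WeakStuffle K X (countable-≟ ι ι-inj) f₁ f₂ f₃
    in IsWeakStuffle → ΔIsAlgebraMorphism →
       ∀ a b → (f₁ a b ≈ 1#) × (f₂ a b ≈ 1#)
mainTheorem14 K X x₀ ι ι-inj f₁ f₂ f₃ _ (_ , multiplicative) a b
  with countable-≟ ι ι-inj a b
... | yes ≡-refl = equal-letters a (multiplicative [ a ] [ a ] [ a ] [ a ])
                                   (multiplicative [ a ] (a ∷ a ∷ []) [ a ] (a ∷ a ∷ []))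
  where open Coefficients K X (countable-≟ ι ι-inj) f₁ f₂ f₃
... | no a≢b = distinct-letters a≢b (multiplicative [ a ] [ b ] [ a ] [ b ])
                                    (multiplicative [ a ] [ b ] [ b ] [ a ])
  where open Coefficients K X (countable-≟ ι ι-inj) f₁ f₂ f₃
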